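{- For positive integers $n\ge k$, $|\mathrm{ls}(n,k)|$, where $\mathrm{ls}(n,k)=\mathrm{js}_n^k(1)$, equals the number of ordered pairs $(\sigma,\tau)$, where $\sigma$ is a permutation of $[n]_0=\{0,1,\dots,n\}$ with $k$ cycles and $\tau$ is a permutation of $[n]$ with $k$ cycles, such that $1\in\mathrm{Orb}_\sigma(0)$ and $\min(\sigma)=\min(\tau)$.
   Context: The Jacobi–Stirling numbers of the first kind $\mathrm{js}_n^k(z)$ are defined by $\prod_{i=0}^{n-1}(x-i(z+i))=\sum_{k=0}^n\mathrm{js}_n^k(z)x^k$; equivalently $\mathrm{js}_0^0=1$, $\mathrm{js}_n^k=0$ for $n\ge1$, $k\notin\{1,\dots,n\}$, and $\mathrm{js}_n^k(z)=\mathrm{js}_{n-1}^{k-1}(z)-(n-1)(n-1+z)\mathrm{js}_{n-1}^k(z)$ for $n,k\ge1$. For a permutation $\sigma$ of $[n]_0$ (or of $[n]=\{1,\dots,n\}$) and $j$ in its domain, $\mathrm{Orb}_\sigma(j)=\{\sigma^\ell(j):\ell\ge1\}$, and $\min(\sigma)=\{j\in[n]: j=\min(\mathrm{Orb}_\sigma(j)\cap[n])\}$. -}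

module Defs where

open import Data.Nat using (ℕ; zero; suc; _≤_; _≤?_)
import Data.Nat
open import Data.Nat.Properties using ()
open import Data.Integer as ℤ using (ℤ; +_)
open import Data.Fin using (Fin; zero; suc; toℕ; _≟_)
open import Data.Fin.Properties using (any?; all?)
open import Data.Vec using (Vec; []; _∷_; lookup)
open import Data.List using (List; []; _∷_; [_]; map; concatMap; filter; length; allFin; cartesianProduct)
open import Data.Product using (Σ; _×_; _,_; ∃; proj₁; proj₂)
open import Relation.Binary.PropositionalEquality using (_≡_)
open import Relation.Nullary using (Dec; ¬_; ¬?)
open import Relation.Nullary.Decidable using (_×-dec_; _→-dec_)

js : ℕ → ℕ → ℤ → ℤ
js zero    zero    z = + 1
js zero    (suc k) z = + 0
js (suc n) zero    z = + 0
js (suc n) (suc k) z = js n k z ℤ.- ((+ n) ℤ.* (+ n ℤ.+ z)) ℤ.* js n (suc k) z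

ls : ℕ → ℕ → ℤ
ls n k = js n k (+ 1)

allVecs : (m k : ℕ) → List (Vec (Fin m) k)
allVecs m zero    = [ [] ]
allVecs m (suc k) = concatMap (λ x → map (x ∷_) (allVecs m k)) (allFin m)

Injective : {m : ℕ} → Vec (Fin m) m → Set
Injective {m} v = (i j : Fin m) → lookup v i ≡ lookup v j → i ≡ j

injective? : {m : ℕ} → (v : Vec (Fin m) m) → Dec (Injective v)
injective? v = all? λ i → all? λ j → (lookup v i ≟ lookup v j) →-dec (i ≟ j)

perms : (m : ℕ) → List (Vec (Fin m) m)
perms m = filter injective? (allVecs m m)

-- Orbits: Orb_σ(j) = { σ^ℓ(j) : ℓ ≥ 1 }.  On an m-element set it suffices
-- to take 1 ≤ ℓ ≤ m, i.e. ℓ = suc (toℕ l) for l : Fin m.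

iter : {m : ℕ} → Vec (Fin m) m → ℕ → Fin m → Fin m
iter σ zero    x = x
iter σ (suc ℓ) x = lookup σ (iter σ ℓ x)

InOrb : {m : ℕ} → Vec (Fin m) m → Fin m → Fin m → Set
InOrb {m} σ j x = ∃ λ (l : Fin m) → iter σ (suc (toℕ l)) j ≡ x

inOrb? : {m : ℕ} → (σ : Vec (Fin m) m) → (j x : Fin m) → Dec (InOrb σ j x)
inOrb? σ j x = any? λ l → iter σ (suc (toℕ l)) j ≟ x

IsCycleMin : {m : ℕ} → Vec (Fin m) m → Fin m → Set
IsCycleMin {m} σ j = InOrb σ j j × ((x : Fin m) → InOrb σ j x → toℕ j ≤ toℕ x)

isCycleMin? : {m : ℕ} → (σ : Vec (Fin m) m) → (j : Fin m) → Dec (IsCycleMin σ j)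
isCycleMin? σ j = inOrb? σ j j ×-dec all? λ x → inOrb? σ j x →-dec (toℕ j ≤? toℕ x)

-- number of cycles of σ = number of cycle minima
cycles : {m : ℕ} → Vec (Fin m) m → ℕ
cycles {m} σ = length (filter (isCycleMin? σ) (allFin m))

-- Permutations σ of [n]_0 = {0,…,n} are tables on Fin (suc n) (element i ↦ i).
-- Permutations τ of [n] = {1,…,n} are tables on Fin n (element i ↦ i+1).

-- For j = suc i ∈ [n]:  j ∈ min(σ)  iff  j = min (Orb_σ(j) ∩ [n]).
InMinσ : {n : ℕ} → Vec (Fin (suc n)) (suc n) → Fin n → Set
InMinσ {n} σ i =
  InOrb σ (suc i) (suc i) ×
  ((x : Fin (suc n)) → InOrb σ (suc i) x → ¬ (x ≡ zero) → toℕ (suc i) ≤ toℕ x)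

inMinσ? : {n : ℕ} → (σ : Vec (Fin (suc n)) (suc n)) → (i : Fin n) → Dec (InMinσ σ i)
inMinσ? σ i = inOrb? σ (suc i) (suc i) ×-dec
  all? λ x → inOrb? σ (suc i) x →-dec (¬? (x ≟ zero) →-dec (toℕ (suc i) ≤? toℕ x))

-- min(σ) = min(τ) as subsets of [n]   (element i+1 of [n] ↔ i : Fin n;
-- the shift preserves order, so min(τ) is computed on Fin n directly)
SameMins : {n : ℕ} → Vec (Fin (suc n)) (suc n) → Vec (Fin n) n → Set
SameMins {n} σ τ = (i : Fin n) → (InMinσ σ i → IsCycleMin τ i) × (IsCycleMin τ i → InMinσ σ i)

sameMins? : {n : ℕ} → (σ : Vec (Fin (suc n)) (suc n)) → (τ : Vec (Fin n) n) → Dec (SameMins σ τ)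
sameMins? σ τ = all? λ i → (inMinσ? σ i →-dec isCycleMin? τ i) ×-dec (isCycleMin? τ i →-dec inMinσ? σ i)

Good : (n k : ℕ) → Vec (Fin (suc n)) (suc n) × Vec (Fin n) n → Set
Good n k (σ , τ) =
  (cycles σ ≡ k) × (cycles τ ≡ k) ×
  (∃ λ (x : Fin (suc n)) → (toℕ x ≡ 1) × InOrb σ zero x) × SameMins σ τ

good? : (n k : ℕ) → (p : Vec (Fin (suc n)) (suc n) × Vec (Fin n) n) → Dec (Good n k p)
good? n k (σ , τ) =
  (cycles σ Data.Nat.≟ k) ×-dec (cycles τ Data.Nat.≟ k) ×-dec
  (any? λ x → (toℕ x Data.Nat.≟ 1) ×-dec inOrb? σ zero x) ×-dec sameMins? σ τ

countPairs : ℕ → ℕ → ℕ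
countPairs n k = length (filter (good? n k) (cartesianProduct (perms (suc n)) (perms n)))

-- Deleting the largest element N + 1 from a permutation of [N + 1]₀ (or of [N + 1]) leaves a
-- permutation of [N]₀ (or [N]) together with the image of N + 1: either N + 1 was a fixed point,
-- which accounts for one cycle, or it sat just before one of the N + 1 (or N) remaining elements,
-- and then the number of cycles is unchanged.  Being the largest element, N + 1 is the minimum of
-- its cycle exactly when it is fixed; for σ the same holds for the minimum over Orb ∩ [N + 1],
-- because if N + 1 sits just before 0 then 1 ∈ Orb_σ(0) lies in its cycle.  So min(σ) = min(τ)
-- forces N + 1 to be fixed in both or in neither, and the numbers c(N, k) of admissible pairs satisfy
-- c(N + 1, k + 1) = c(N, k) + N (N + 1) c(N, k + 1), the recurrence of (-1)^(n+k) ls(n, k).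

module Submission where

open import Defs
open import Data.Nat as ℕ using (ℕ; zero; suc; _+_; _*_; _∸_; _<_; _≤_)
import Data.Nat.Properties as ℕ
open import Data.Nat.Induction using (<-rec)
open import Data.Integer as ℤ using (+_; ∣_∣; -1ℤ; _^_)
import Data.Integer.Properties as ℤ
open import Data.Integer.Tactic.RingSolver using (solve-∀)
open import Data.Bool using (true; false)
open import Data.Unit using (⊤; tt)
open import Data.Fin using (Fin; zero; suc; toℕ; inject₁; fromℕ; fromℕ<; _≟_)
open import Data.Fin.Properties
  using (inject₁-injective; fromℕ≢inject₁; toℕ-fromℕ; inject₁ℕ<; toℕ-inject₁; toℕ-fromℕ<; toℕ<n; pigeonhole)
open import Data.Maybe as Maybe using (Maybe; just; nothing; maybe; fromMaybe)
open import Data.Vec using (Vec; []; _∷_; lookup; tabulate)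
open import Data.Vec.Properties using (lookup∘tabulate; tabulate-cong; tabulate∘lookup)
open import Data.List as List
  using (List; []; _∷_; [_]; map; filter; length; allFin; cartesianProduct; cartesianProductWith; concatMap; _++_)
import Data.List.Properties as List
open import Data.List.Membership.Propositional using (_∈_)
import Data.List.Membership.Propositional.Properties as ∈
open import Data.List.Membership.Propositional.Properties.WithK using (unique∧set⇒bag)
open import Data.List.Relation.Unary.Any using (here)
open import Data.List.Relation.Unary.All using ([])
open import Data.List.Relation.Unary.AllPairs using ([]; _∷_)
open import Data.List.Relation.Unary.Unique.Propositional using (Unique)
import Data.List.Relation.Unary.Unique.Propositional.Properties as Unique
open import Data.List.Relation.Binary.BagAndSetEquality using (∼bag⇒↭)
open import Data.List.Relation.Binary.Permutation.Propositional.Properties using (↭-length)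
open import Data.Product using (∃; _×_; _,_; proj₁; proj₂)
open import Data.Sum using (_⊎_; inj₁; inj₂)
open import Function using (_∘_; id; _⇔_; mk⇔; Equivalence)
open import Function.Construct.Composition using (_⇔-∘_)
open import Function.Construct.Identity using (⇔-id)
open import Function.Construct.Symmetry using (⇔-sym)
open import Relation.Binary.PropositionalEquality hiding ([_])
open import Relation.Nullary using (yes; no; ¬_; does; contradiction)
open import Relation.Unary using (Pred; Decidable)

private variable
  A B : Set
  m n : ℕ

-- Unsigned Jacobi–Stirling numbers

lsᵘ : ℕ → ℕ → ℕ
lsᵘ zero    zero    = 1
lsᵘ zero    (suc k) = 0
lsᵘ (suc n) zero    = 0
lsᵘ (suc n) (suc k) = lsᵘ n k + n * suc n * lsᵘ n (suc k)

ls≡sign*lsᵘ : ∀ n k → ls n k ≡ -1ℤ ^ (n + k) ℤ.* + lsᵘ n k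
ls≡sign*lsᵘ zero    zero    = refl
ls≡sign*lsᵘ zero    (suc k) = sym (ℤ.*-zeroʳ (-1ℤ ^ suc k))
ls≡sign*lsᵘ (suc n) zero    = sym (ℤ.*-zeroʳ (-1ℤ ^ (suc n + 0)))
ls≡sign*lsᵘ (suc n) (suc k) = begin
  ls n k ℤ.- + n ℤ.* (+ n ℤ.+ + 1) ℤ.* ls n (suc k)
    ≡⟨ cong₂ (λ x y → x ℤ.- + n ℤ.* (+ n ℤ.+ + 1) ℤ.* y) (ls≡sign*lsᵘ n k) (ls≡sign*lsᵘ n (suc k)) ⟩
  s ℤ.* + a ℤ.- + n ℤ.* (+ n ℤ.+ + 1) ℤ.* (-1ℤ ^ (n + suc k) ℤ.* + b)
    ≡⟨ cong (λ e → s ℤ.* + a ℤ.- + n ℤ.* (+ n ℤ.+ + 1) ℤ.* (-1ℤ ^ e ℤ.* + b)) (ℕ.+-suc n k) ⟩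
  s ℤ.* + a ℤ.- + n ℤ.* (+ n ℤ.+ + 1) ℤ.* (-1ℤ ℤ.* s ℤ.* + b)
    ≡⟨ recurrence s (+ a) (+ b) (+ n) ⟩
  -1ℤ ℤ.* (-1ℤ ℤ.* s) ℤ.* (+ a ℤ.+ + n ℤ.* (+ 1 ℤ.+ + n) ℤ.* + b)
    ≡⟨ cong₂ ℤ._*_ (cong (λ e → -1ℤ ℤ.* -1ℤ ^ e) (sym (ℕ.+-suc n k))) (sym +-lsᵘ-suc) ⟩
  -1ℤ ^ (suc n + suc k) ℤ.* + lsᵘ (suc n) (suc k) ∎
  where
  open ≡-Reasoning
  s = -1ℤ ^ (n + k)
  a = lsᵘ n k
  b = lsᵘ n (suc k)
  recurrence : ∀ s a b n → s ℤ.* a ℤ.- n ℤ.* (n ℤ.+ + 1) ℤ.* (-1ℤ ℤ.* s ℤ.* b)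
                         ≡ -1ℤ ℤ.* (-1ℤ ℤ.* s) ℤ.* (a ℤ.+ n ℤ.* (+ 1 ℤ.+ n) ℤ.* b)
  recurrence = solve-∀
  +-lsᵘ-suc : + lsᵘ (suc n) (suc k) ≡ + a ℤ.+ + n ℤ.* (+ 1 ℤ.+ + n) ℤ.* + b
  +-lsᵘ-suc = trans (ℤ.pos-+ a _) (cong (ℤ._+_ (+ a))
    (trans (ℤ.pos-* (n * suc n) b) (cong (ℤ._* + b) (trans (ℤ.pos-* n (suc n)) (cong (+ n ℤ.*_) (ℤ.pos-+ 1 n))))))

∣-1^n∣≡1 : ∀ n → ∣ -1ℤ ^ n ∣ ≡ 1
∣-1^n∣≡1 zero    = refl
∣-1^n∣≡1 (suc n) = trans (cong ∣_∣ (ℤ.-1*i≡-i (-1ℤ ^ n))) (trans (ℤ.∣-i∣≡∣i∣ (-1ℤ ^ n)) (∣-1^n∣≡1 n))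

∣ls∣≡lsᵘ : ∀ n k → ∣ ls n k ∣ ≡ lsᵘ n k
∣ls∣≡lsᵘ n k = begin
  ∣ ls n k ∣                               ≡⟨ cong ∣_∣ (ls≡sign*lsᵘ n k) ⟩
  ∣ -1ℤ ^ (n + k) ℤ.* + lsᵘ n k ∣        ≡⟨ ℤ.∣i*j∣≡∣i∣*∣j∣ (-1ℤ ^ (n + k)) _ ⟩
  ∣ -1ℤ ^ (n + k) ∣ * lsᵘ n k          ≡⟨ cong (_* lsᵘ n k) (∣-1^n∣≡1 (n + k)) ⟩
  1 * lsᵘ n k                            ≡⟨ ℕ.*-identityˡ _ ⟩
  lsᵘ n k ∎
  where open ≡-Reasoning

length-unique : {xs ys : List A} → Unique xs → Unique ys → (∀ {z} → z ∈ xs ⇔ z ∈ ys) → length xs ≡ length ys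
length-unique uxs uys xs⇔ys = ↭-length (∼bag⇒↭ (unique∧set⇒bag uxs uys xs⇔ys))

length-cartesianProduct : (xs : List A) (ys : List B) → length (cartesianProduct xs ys) ≡ length xs * length ys
length-cartesianProduct []       ys = refl
length-cartesianProduct (x ∷ xs) ys = begin
  length (map (x ,_) ys ++ cartesianProduct xs ys)        ≡⟨ List.length-++ (map (x ,_) ys) ⟩
  length (map (x ,_) ys) + length (cartesianProduct xs ys) ≡⟨ cong₂ _+_ (List.length-map (x ,_) ys) (length-cartesianProduct xs ys) ⟩
  length ys + length xs * length ys ∎
  where open ≡-Reasoning

module _ {p q} {P : Pred A p} {Q : Pred B q} (P? : Decidable P) (Q? : Decidable Q) where

  length-filter-tabulate-cong : ∀ {n} {f : Fin n → A} {g : Fin n → B} → (∀ i → P (f i) ⇔ Q (g i)) →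
    length (filter P? (List.tabulate f)) ≡ length (filter Q? (List.tabulate g))
  length-filter-tabulate-cong {zero}          f⇔g = refl
  length-filter-tabulate-cong {suc n} {f} {g} f⇔g
    with P? (f zero) | Q? (g zero) | length-filter-tabulate-cong {n} {f ∘ suc} {g ∘ suc} (f⇔g ∘ suc)
  ... | yes _  | yes _ | eq = cong suc eq
  ... | no  _  | no _  | eq = eq
  ... | yes pf | no ¬qg | _ = contradiction (Equivalence.to (f⇔g zero) pf) ¬qg
  ... | no ¬pf | yes qg | _ = contradiction (Equivalence.from (f⇔g zero) qg) ¬pf

length-filter-tabulate-suc : ∀ {p} {P : Pred A p} (P? : Decidable P) {m} (f : Fin (suc m) → A) →
  length (filter P? (List.tabulate f)) ≡ length (filter P? (List.tabulate (f ∘ inject₁))) + length (filter P? [ f (fromℕ m) ])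
length-filter-tabulate-suc P? {zero}  f = refl
length-filter-tabulate-suc P? {suc m} f with does (P? (f zero)) | length-filter-tabulate-suc P? (f ∘ suc)
... | true  | eq = cong suc eq
... | false | eq = eq

allVecs-suc : ∀ m k → allVecs m (suc k) ≡ cartesianProductWith _∷_ (allFin m) (allVecs m k)
allVecs-suc m k = go (allFin m)
  where
  go : ∀ xs → concatMap (λ x → map (x ∷_) (allVecs m k)) xs ≡ cartesianProductWith _∷_ xs (allVecs m k)
  go []       = refl
  go (x ∷ xs) = cong (map (x ∷_) (allVecs m k) ++_) (go xs)

allVecs-unique : ∀ m k → Unique (allVecs m k)
allVecs-unique m zero    = [] ∷ []
allVecs-unique m (suc k) rewrite allVecs-suc m k =
  Unique.cartesianProductWith⁺ _∷_ (λ { refl → refl , refl }) (Unique.allFin⁺ m) (allVecs-unique m k)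

∈-allVecs : ∀ {m k} (v : Vec (Fin m) k) → v ∈ allVecs m k
∈-allVecs {m} {zero}  []      = here refl
∈-allVecs {m} {suc k} (x ∷ v) rewrite allVecs-suc m k =
  ∈.∈-cartesianProductWith⁺ _∷_ (∈.∈-allFin x) (∈-allVecs v)

perms-unique : ∀ m → Unique (perms m)
perms-unique m = Unique.filter⁺ injective? (allVecs-unique m m)

∈-perms⇔ : ∀ {m} {v : Vec (Fin m) m} → v ∈ perms m ⇔ Injective v
∈-perms⇔ {m} {v} = mk⇔ (proj₂ ∘ ∈.∈-filter⁻ injective? {xs = allVecs m m}) (∈.∈-filter⁺ injective? (∈-allVecs v))

-- Deleting and inserting the top element

data TopView {m} (x : Fin (suc m)) : Set where
  below  : (i : Fin m) → x ≡ inject₁ i → TopView x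
  at-top : x ≡ fromℕ m → TopView x

topView : (x : Fin (suc m)) → TopView x
topView {zero}  zero    = at-top refl
topView {suc m} zero    = below zero refl
topView {suc m} (suc x) with topView x
... | below i refl = below (suc i) refl
... | at-top refl  = at-top refl

lower : Fin (suc m) → Maybe (Fin m)
lower {zero}  zero    = nothing
lower {suc m} zero    = just zero
lower {suc m} (suc x) = Maybe.map suc (lower x)

lower-inject₁ : (i : Fin m) → lower (inject₁ i) ≡ just i
lower-inject₁ {suc m} zero    = refl
lower-inject₁ {suc m} (suc i) = cong (Maybe.map suc) (lower-inject₁ i)

lower-fromℕ : ∀ m → lower (fromℕ m) ≡ nothing
lower-fromℕ zero    = refl
lower-fromℕ (suc m) = cong (Maybe.map suc) (lower-fromℕ m)

inject₁≢fromℕ : {i : Fin m} → inject₁ i ≢ fromℕ m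
inject₁≢fromℕ = fromℕ≢inject₁ ∘ sym

-- A pointer p : Maybe (Fin m) says where the top element m goes when it is inserted
-- into a permutation of Fin m: nothing makes it a fixed point, just c inserts it
-- into the cycle of c, just before c.

topImage : Maybe (Fin m) → Fin (suc m)
topImage nothing  = fromℕ _
topImage (just c) = inject₁ c

redirect : Maybe (Fin m) → Fin m → Fin (suc m)
redirect nothing  y = inject₁ y
redirect (just c) y with y ≟ c
... | yes _ = fromℕ _
... | no  _ = inject₁ y

lower-topImage : (p : Maybe (Fin m)) → lower (topImage p) ≡ p
lower-topImage {m} nothing = lower-fromℕ m
lower-topImage (just c)    = lower-inject₁ c

redirect-self : (c : Fin m) → redirect (just c) c ≡ fromℕ m
redirect-self c with c ≟ c
... | yes _   = refl
... | no  c≢c = contradiction refl c≢c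

redirect-other : {c y : Fin m} → y ≢ c → redirect (just c) y ≡ inject₁ y
redirect-other {c = c} {y} y≢c with y ≟ c
... | yes y≡c = contradiction y≡c y≢c
... | no  _   = refl

redirect-cases : (p : Maybe (Fin m)) (y : Fin m) →
  redirect p y ≡ inject₁ y ⊎ (redirect p y ≡ fromℕ m × topImage p ≡ inject₁ y)
redirect-cases nothing  y = inj₁ refl
redirect-cases (just c) y with y ≟ c
... | yes refl = inj₂ (refl , refl)
... | no  _    = inj₁ refl

redirect-injective : (p : Maybe (Fin m)) {y y′ : Fin m} → redirect p y ≡ redirect p y′ → y ≡ y′
redirect-injective nothing  eq = inject₁-injective eq
redirect-injective (just c) {y} {y′} eq with y ≟ c | y′ ≟ c
... | yes y≡c | yes y′≡c = trans y≡c (sym y′≡c)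
... | yes _   | no  _    = contradiction eq fromℕ≢inject₁
... | no  _   | yes _    = contradiction eq inject₁≢fromℕ
... | no  _   | no  _    = inject₁-injective eq

redirect≢topImage : (p : Maybe (Fin m)) (y : Fin m) → redirect p y ≢ topImage p
redirect≢topImage nothing  y eq = inject₁≢fromℕ eq
redirect≢topImage (just c) y eq with y ≟ c
... | yes _   = fromℕ≢inject₁ eq
... | no  y≢c = y≢c (inject₁-injective eq)

topImage-lower : (x : Fin (suc m)) → topImage (lower x) ≡ x
topImage-lower x with topView x
... | below i refl = cong topImage (lower-inject₁ i)
... | at-top refl  = cong topImage (lower-fromℕ _)

lower-redirect : (p : Maybe (Fin m)) (d y : Fin m) → fromMaybe (fromMaybe d p) (lower (redirect p y)) ≡ y
lower-redirect nothing  d y = cong (fromMaybe d) (lower-inject₁ y)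
lower-redirect (just c) d y with y ≟ c
... | yes y≡c = trans (cong (fromMaybe c) (lower-fromℕ _)) (sym y≡c)
... | no  _   = cong (fromMaybe c) (lower-inject₁ y)

redirect-lower : (d : Fin m) (y t : Fin (suc m)) → y ≢ t →
  redirect (lower t) (fromMaybe (fromMaybe d (lower t)) (lower y)) ≡ y
redirect-lower {m} d y t y≢t with topView y | topView t
... | below a refl | below c refl
    rewrite lower-inject₁ a | lower-inject₁ c = redirect-other λ { refl → y≢t refl }
... | below a refl | at-top refl
    rewrite lower-inject₁ a | lower-fromℕ m = refl
... | at-top refl  | below c refl
    rewrite lower-inject₁ c | lower-fromℕ m = redirect-self c
... | at-top refl  | at-top refl = contradiction refl y≢t

private
  insertTopAt : Maybe (Fin m) → Vec (Fin m) m → Fin (suc m) → Fin (suc m)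
  insertTopAt p σ = maybe (redirect p ∘ lookup σ) (topImage p) ∘ lower

insertTop : Maybe (Fin m) → Vec (Fin m) m → Vec (Fin (suc m)) (suc m)
insertTop p σ = tabulate (insertTopAt p σ)

topPointer : Vec (Fin (suc m)) (suc m) → Maybe (Fin m)
topPointer σ = lower (lookup σ (fromℕ _))

-- Both defaults are junk for a permutation σ: σ (inject₁ i) is the top only if the top is not fixed.
deleteTop : Vec (Fin (suc m)) (suc m) → Vec (Fin m) m
deleteTop σ = tabulate λ i → fromMaybe (fromMaybe i (topPointer σ)) (lower (lookup σ (inject₁ i)))

module _ (p : Maybe (Fin m)) (σ : Vec (Fin m) m) where

  lookup-insertTop-inject₁ : ∀ i → lookup (insertTop p σ) (inject₁ i) ≡ redirect p (lookup σ i)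
  lookup-insertTop-inject₁ i =
    trans (lookup∘tabulate (insertTopAt p σ) (inject₁ i)) (cong (maybe (redirect p ∘ lookup σ) (topImage p)) (lower-inject₁ i))

  lookup-insertTop-fromℕ : lookup (insertTop p σ) (fromℕ m) ≡ topImage p
  lookup-insertTop-fromℕ =
    trans (lookup∘tabulate (insertTopAt p σ) (fromℕ m)) (cong (maybe (redirect p ∘ lookup σ) (topImage p)) (lower-fromℕ m))

  topPointer-insertTop : topPointer (insertTop p σ) ≡ p
  topPointer-insertTop = trans (cong lower lookup-insertTop-fromℕ) (lower-topImage p)

  deleteTop-insertTop : deleteTop (insertTop p σ) ≡ σ
  deleteTop-insertTop = trans (tabulate-cong restore) (tabulate∘lookup σ)
    where
    restore : ∀ i → fromMaybe (fromMaybe i (topPointer (insertTop p σ))) (lower (lookup (insertTop p σ) (inject₁ i)))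
                  ≡ lookup σ i
    restore i rewrite topPointer-insertTop | lookup-insertTop-inject₁ i = lower-redirect p i (lookup σ i)

  insertTop-injective : Injective σ → Injective (insertTop p σ)
  insertTop-injective σ-inj x y eq with topView x | topView y
  ... | below i refl | below j refl = cong inject₁ (σ-inj i j (redirect-injective p
          (trans (sym (lookup-insertTop-inject₁ i)) (trans eq (lookup-insertTop-inject₁ j)))))
  ... | below i refl | at-top refl = contradiction
          (trans (sym (lookup-insertTop-inject₁ i)) (trans eq lookup-insertTop-fromℕ)) (redirect≢topImage p _)
  ... | at-top refl | below j refl = contradiction
          (trans (sym (lookup-insertTop-inject₁ j)) (trans (sym eq) lookup-insertTop-fromℕ)) (redirect≢topImage p _)
  ... | at-top refl | at-top refl = refl

module _ (σ : Vec (Fin (suc m)) (suc m)) (σ-inj : Injective σ) where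

  redirect-deleteTop : ∀ i → redirect (topPointer σ) (lookup (deleteTop σ) i) ≡ lookup σ (inject₁ i)
  redirect-deleteTop i = trans (cong (redirect (topPointer σ)) (lookup∘tabulate _ i))
    (redirect-lower i (lookup σ (inject₁ i)) (lookup σ (fromℕ m)) (inject₁≢fromℕ ∘ σ-inj _ _))

  insertTop-deleteTop : insertTop (topPointer σ) (deleteTop σ) ≡ σ
  insertTop-deleteTop = trans (tabulate-cong restore) (tabulate∘lookup σ)
    where
    restore : ∀ x → insertTopAt (topPointer σ) (deleteTop σ) x ≡ lookup σ x
    restore x with topView x
    ... | below i refl rewrite lower-inject₁ i = redirect-deleteTop i
    ... | at-top refl  rewrite lower-fromℕ m = topImage-lower (lookup σ (fromℕ m))

  deleteTop-injective : Injective (deleteTop σ)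
  deleteTop-injective i j eq = inject₁-injective (σ-inj _ _
    (trans (sym (redirect-deleteTop i)) (trans (cong (redirect (topPointer σ)) eq) (redirect-deleteTop j))))

inject₁<fromℕ : (i : Fin m) → toℕ (inject₁ i) ℕ.< toℕ (fromℕ m)
inject₁<fromℕ {m} i = subst (toℕ (inject₁ i) ℕ.<_) (sym (toℕ-fromℕ m)) (inject₁ℕ< i)

-- Orbits

Reach : Vec (Fin m) m → Fin m → Fin m → Set
Reach σ a b = ∃ λ ℓ → iter σ (suc ℓ) a ≡ b

module _ (σ : Vec (Fin m) m) where

  iter-+ : ∀ i j a → iter σ (i + j) a ≡ iter σ i (iter σ j a)
  iter-+ zero    j a = refl
  iter-+ (suc i) j a = cong (lookup σ) (iter-+ i j a)

  reach-trans : ∀ {a b c} → Reach σ a b → Reach σ b c → Reach σ a c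
  reach-trans {a} (i , refl) (j , refl) = j + suc i , iter-+ (suc j) (suc i) a

  -- Two of the m + 1 iterates σ¹ a, …, σᵐ⁺¹ a coincide; cutting out the loop between
  -- them shortens every path of length at least m.
  shorten : ∀ a ℓ → m ≤ ℓ → ∃ λ ℓ′ → ℓ′ < ℓ × iter σ (suc ℓ′) a ≡ iter σ (suc ℓ) a
  shorten a ℓ m≤ℓ with pigeonhole (ℕ.n<1+n m) (λ (i : Fin (suc m)) → iter σ (suc (toℕ i)) a)
  ... | i , j , i<j , loop = r + toℕ i , shorter , (begin
    iter σ (suc (r + toℕ i)) a    ≡⟨ cong (λ t → iter σ t a) (ℕ.+-suc r (toℕ i)) ⟨
    iter σ (r + suc (toℕ i)) a    ≡⟨ iter-+ r (suc (toℕ i)) a ⟩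
    iter σ r (iter σ (suc (toℕ i)) a) ≡⟨ cong (iter σ r) loop ⟩
    iter σ r (iter σ (suc (toℕ j)) a) ≡⟨ iter-+ r (suc (toℕ j)) a ⟨
    iter σ (r + suc (toℕ j)) a    ≡⟨ cong (λ t → iter σ t a) (trans (ℕ.+-suc r (toℕ j)) (cong suc r+j≡ℓ)) ⟩
    iter σ (suc ℓ) a ∎)
    where
    open ≡-Reasoning
    r = ℓ ∸ toℕ j
    r+j≡ℓ : r + toℕ j ≡ ℓ
    r+j≡ℓ = ℕ.m∸n+n≡m (ℕ.≤-trans (ℕ.≤-pred (toℕ<n j)) m≤ℓ)
    shorter : r + toℕ i < ℓ
    shorter = ℕ.<-≤-trans (ℕ.+-monoʳ-< r i<j) (ℕ.≤-reflexive r+j≡ℓ)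

  inOrb⇔reach : ∀ {a b} → InOrb σ a b ⇔ Reach σ a b
  inOrb⇔reach {a} {b} = mk⇔ (λ (l , eq) → toℕ l , eq) (λ (ℓ , eq) → bounded ℓ eq)
    where
    bounded : ∀ ℓ → iter σ (suc ℓ) a ≡ b → InOrb σ a b
    bounded = <-rec (λ ℓ → iter σ (suc ℓ) a ≡ b → InOrb σ a b) step
      where
      step : ∀ ℓ → (∀ {ℓ′} → ℓ′ < ℓ → iter σ (suc ℓ′) a ≡ b → InOrb σ a b) → iter σ (suc ℓ) a ≡ b → InOrb σ a b
      step ℓ rec eq with ℓ ℕ.<? m
      ... | yes ℓ<m = fromℕ< ℓ<m , trans (cong (λ t → iter σ (suc t) a) (toℕ-fromℕ< ℓ<m)) eq
      ... | no  ℓ≮m with shorten a ℓ (ℕ.≮⇒≥ ℓ≮m)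
      ...   | ℓ′ , ℓ′<ℓ , eq′ = rec ℓ′<ℓ (trans eq′ eq)

module _ (p : Maybe (Fin m)) (σ′ : Vec (Fin m) m) where

  private
    σ : Vec (Fin (suc m)) (suc m)
    σ = insertTop p σ′

  step-inject₁ : ∀ y → lookup σ (inject₁ y) ≡ inject₁ (lookup σ′ y)
                     ⊎ (lookup σ (inject₁ y) ≡ fromℕ m × topImage p ≡ inject₁ (lookup σ′ y))
  step-inject₁ y rewrite lookup-insertTop-inject₁ p σ′ y = redirect-cases p (lookup σ′ y)

  reach-inject₁-step : ∀ y → Reach σ (inject₁ y) (inject₁ (lookup σ′ y))
  reach-inject₁-step y with step-inject₁ y
  ... | inj₁ eq        = 0 , eq
  ... | inj₂ (eq , eq′) = 1 , trans (cong (lookup σ) eq) (trans (lookup-insertTop-fromℕ p σ′) eq′)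

  reach-fromℕ-topImage : Reach σ (fromℕ m) (topImage p)
  reach-fromℕ-topImage = 0 , lookup-insertTop-fromℕ p σ′

  -- A σ-path from inject₁ a follows the σ′-orbit of a, with detours through the top.
  private
    Detour : Fin m → Fin (suc m) → Set
    Detour a x = (∃ λ q → x ≡ inject₁ (iter σ′ (suc q) a))
               ⊎ (x ≡ fromℕ m × ∃ λ q → topImage p ≡ inject₁ (iter σ′ (suc q) a))

    detour : ∀ a ℓ → Detour a (iter σ (suc ℓ) (inject₁ a))
    detour a zero with step-inject₁ a
    ... | inj₁ eq         = inj₁ (0 , eq)
    ... | inj₂ (eq , eq′) = inj₂ (eq , 0 , eq′)
    detour a (suc ℓ) with detour a ℓ
    ... | inj₂ (eq , q , eq′) = inj₁ (q , trans (cong (lookup σ) eq) (trans (lookup-insertTop-fromℕ p σ′) eq′))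
    ... | inj₁ (q , eq) with step-inject₁ (iter σ′ (suc q) a)
    ...   | inj₁ eq′         = inj₁ (suc q , trans (cong (lookup σ) eq) eq′)
    ...   | inj₂ (eq′ , eq″) = inj₂ (trans (cong (lookup σ) eq) eq′ , suc q , eq″)

    follow : ∀ a ℓ → Reach σ (inject₁ a) (inject₁ (iter σ′ (suc ℓ) a))
    follow a zero    = reach-inject₁-step a
    follow a (suc ℓ) = reach-trans σ (follow a ℓ) (reach-inject₁-step _)

  reach-inject₁⇔ : ∀ {a b} → Reach σ (inject₁ a) (inject₁ b) ⇔ Reach σ′ a b
  reach-inject₁⇔ {a} = mk⇔ to (λ { (ℓ , refl) → follow a ℓ })
    where
    to : ∀ {b} → Reach σ (inject₁ a) (inject₁ b) → Reach σ′ a b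
    to (ℓ , eq) with detour a ℓ
    ... | inj₁ (q , eq′)    = q , inject₁-injective (trans (sym eq′) eq)
    ... | inj₂ (eq′ , _)    = contradiction (trans (sym eq) eq′) inject₁≢fromℕ

  inOrb-inject₁⇔ : ∀ {a b} → InOrb σ (inject₁ a) (inject₁ b) ⇔ InOrb σ′ a b
  inOrb-inject₁⇔ = ⇔-sym (inOrb⇔reach σ′) ⇔-∘ (reach-inject₁⇔ ⇔-∘ inOrb⇔reach σ)

reach-fromℕ-insertTop-nothing : (σ′ : Vec (Fin m) m) → ∀ {x} → Reach (insertTop nothing σ′) (fromℕ m) x → x ≡ fromℕ m
reach-fromℕ-insertTop-nothing {m} σ′ (ℓ , eq) = trans (sym eq) (fixed (suc ℓ))
  where
  fixed : ∀ ℓ → iter (insertTop nothing σ′) ℓ (fromℕ m) ≡ fromℕ m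
  fixed zero    = refl
  fixed (suc ℓ) = trans (cong (lookup (insertTop nothing σ′)) (fixed ℓ)) (lookup-insertTop-fromℕ nothing σ′)

-- Cycle minima

-- IsCycleMin is the case Q = ⊤, and InMinσ σ i is LeastInOrb (_≢ zero) σ (suc i).
LeastInOrb : (Fin m → Set) → Vec (Fin m) m → Fin m → Set
LeastInOrb {m} Q σ j = InOrb σ j j × ((x : Fin m) → InOrb σ j x → Q x → toℕ j ≤ toℕ x)

isCycleMin⇔leastInOrb : (σ : Vec (Fin m) m) {j : Fin m} → IsCycleMin σ j ⇔ LeastInOrb (λ _ → ⊤) σ j
isCycleMin⇔leastInOrb σ = mk⇔ (λ (o , least) → o , λ x ox _ → least x ox) (λ (o , least) → o , λ x ox → least x ox tt)

leastInOrb-fromℕ-insertTop-nothing : ∀ {Q} (σ′ : Vec (Fin m) m) → LeastInOrb Q (insertTop nothing σ′) (fromℕ m)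
leastInOrb-fromℕ-insertTop-nothing σ′ =
  Equivalence.from (inOrb⇔reach (insertTop nothing σ′)) (0 , lookup-insertTop-fromℕ nothing σ′) ,
  λ x ox _ → ℕ.≤-reflexive (cong toℕ (sym (reach-fromℕ-insertTop-nothing σ′ (Equivalence.to (inOrb⇔reach (insertTop nothing σ′)) ox))))

¬leastInOrb-fromℕ : ∀ {Q} (σ : Vec (Fin (suc m)) (suc m)) y →
  InOrb σ (fromℕ m) (inject₁ y) → Q (inject₁ y) → ¬ LeastInOrb Q σ (fromℕ m)
¬leastInOrb-fromℕ σ y oy qy (_ , least) = ℕ.<⇒≱ (inject₁<fromℕ y) (least (inject₁ y) oy qy)

module _ {Q : Fin (suc m) → Set} {Q′ : Fin m → Set} (Q⇔Q′ : ∀ y → Q (inject₁ y) ⇔ Q′ y)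
         (p : Maybe (Fin m)) (σ′ : Vec (Fin m) m) where

  private
    σ : Vec (Fin (suc m)) (suc m)
    σ = insertTop p σ′

  leastInOrb-inject₁⇔ : ∀ {a} → LeastInOrb Q σ (inject₁ a) ⇔ LeastInOrb Q′ σ′ a
  leastInOrb-inject₁⇔ {a} = mk⇔
    (λ (o , least) → orb⇒ o , λ y oy qy →
      subst₂ _≤_ (toℕ-inject₁ a) (toℕ-inject₁ y) (least (inject₁ y) (orb⇐ oy) (Equivalence.from (Q⇔Q′ y) qy)))
    (λ (o , least) → orb⇐ o , bound least)
    where
    orb⇒ : ∀ {y} → InOrb σ (inject₁ a) (inject₁ y) → InOrb σ′ a y
    orb⇒ = Equivalence.to (inOrb-inject₁⇔ p σ′)
    orb⇐ : ∀ {y} → InOrb σ′ a y → InOrb σ (inject₁ a) (inject₁ y)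
    orb⇐ = Equivalence.from (inOrb-inject₁⇔ p σ′)
    bound : (∀ y → InOrb σ′ a y → Q′ y → toℕ a ≤ toℕ y) → ∀ x → InOrb σ (inject₁ a) x → Q x → toℕ (inject₁ a) ≤ toℕ x
    bound least x ox qx with topView x
    ... | below y refl = subst₂ _≤_ (sym (toℕ-inject₁ a)) (sym (toℕ-inject₁ y))
                           (least y (orb⇒ ox) (Equivalence.to (Q⇔Q′ y) qx))
    ... | at-top refl  = ℕ.<⇒≤ (inject₁<fromℕ a)

module _ (p : Maybe (Fin m)) (σ′ : Vec (Fin m) m) where

  isCycleMin-inject₁⇔ : ∀ {a} → IsCycleMin (insertTop p σ′) (inject₁ a) ⇔ IsCycleMin σ′ a
  isCycleMin-inject₁⇔ =
    ⇔-sym (isCycleMin⇔leastInOrb σ′) ⇔-∘ (leastInOrb-inject₁⇔ (λ _ → ⇔-id ⊤) p σ′ ⇔-∘ isCycleMin⇔leastInOrb (insertTop p σ′))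

  cycles-insertTop : cycles (insertTop p σ′)
                   ≡ cycles σ′ + length (filter (isCycleMin? (insertTop p σ′)) [ fromℕ m ])
  cycles-insertTop = trans (length-filter-tabulate-suc (isCycleMin? (insertTop p σ′)) id)
    (cong (_+ length (filter (isCycleMin? (insertTop p σ′)) [ fromℕ m ]))
      (length-filter-tabulate-cong (isCycleMin? (insertTop p σ′)) (isCycleMin? σ′) {f = inject₁} {g = id}
        (λ _ → isCycleMin-inject₁⇔)))

isCycleMin-fromℕ-nothing : (σ′ : Vec (Fin m) m) → IsCycleMin (insertTop nothing σ′) (fromℕ m)
isCycleMin-fromℕ-nothing σ′ = Equivalence.from (isCycleMin⇔leastInOrb (insertTop nothing σ′))
  (leastInOrb-fromℕ-insertTop-nothing σ′)

¬isCycleMin-fromℕ-just : (c : Fin m) (σ′ : Vec (Fin m) m) → ¬ IsCycleMin (insertTop (just c) σ′) (fromℕ m)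
¬isCycleMin-fromℕ-just c σ′ = ¬leastInOrb-fromℕ σ c (Equivalence.from (inOrb⇔reach σ) (reach-fromℕ-topImage (just c) σ′)) tt
  ∘ Equivalence.to (isCycleMin⇔leastInOrb σ)
  where σ = insertTop (just c) σ′

cycles-insertTop-nothing : (σ′ : Vec (Fin m) m) → cycles (insertTop nothing σ′) ≡ suc (cycles σ′)
cycles-insertTop-nothing {m} σ′ = begin
  cycles (insertTop nothing σ′)                      ≡⟨ cycles-insertTop nothing σ′ ⟩
  cycles σ′ + length (filter isMin? [ fromℕ m ])   ≡⟨ cong (λ xs → cycles σ′ + length xs)
                                                          (List.filter-accept isMin? (isCycleMin-fromℕ-nothing σ′)) ⟩
  cycles σ′ + 1                                     ≡⟨ ℕ.+-comm (cycles σ′) 1 ⟩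
  suc (cycles σ′) ∎
  where
  open ≡-Reasoning
  isMin? = isCycleMin? (insertTop nothing σ′)

cycles-insertTop-just : (c : Fin m) (σ′ : Vec (Fin m) m) → cycles (insertTop (just c) σ′) ≡ cycles σ′
cycles-insertTop-just {m} c σ′ = begin
  cycles (insertTop (just c) σ′)                     ≡⟨ cycles-insertTop (just c) σ′ ⟩
  cycles σ′ + length (filter isMin? [ fromℕ m ])   ≡⟨ cong (λ xs → cycles σ′ + length xs)
                                                          (List.filter-reject isMin? (¬isCycleMin-fromℕ-just c σ′)) ⟩
  cycles σ′ + 0                                     ≡⟨ ℕ.+-identityʳ (cycles σ′) ⟩
  cycles σ′ ∎
  where
  open ≡-Reasoning
  isMin? = isCycleMin? (insertTop (just c) σ′)

OneInOrbZero : Vec (Fin (suc n)) (suc n) → Set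
OneInOrbZero {n} σ = ∃ λ (x : Fin (suc n)) → (toℕ x ≡ 1) × InOrb σ zero x

oneInOrbZero-insertTop⇔ : (p : Maybe (Fin (suc (suc n)))) (σ′ : Vec (Fin (suc (suc n))) (suc (suc n))) →
  OneInOrbZero (insertTop p σ′) ⇔ OneInOrbZero σ′
oneInOrbZero-insertTop⇔ {n} p σ′ = mk⇔ to
  (λ (y , y≡1 , oy) → inject₁ y , trans (toℕ-inject₁ y) y≡1 , Equivalence.from (inOrb-inject₁⇔ p σ′) oy)
  where
  to : OneInOrbZero (insertTop p σ′) → OneInOrbZero σ′
  to (x , x≡1 , ox) with topView x
  ... | below y refl = y , trans (sym (toℕ-inject₁ y)) x≡1 , Equivalence.to (inOrb-inject₁⇔ p σ′) ox
  ... | at-top refl  = contradiction (trans (sym (toℕ-fromℕ (suc (suc n)))) x≡1) λ ()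

inject₁≢zero⇔ : (y : Fin (suc n)) → (¬ inject₁ y ≡ zero) ⇔ (¬ y ≡ zero)
inject₁≢zero⇔ y = mk⇔ (λ ne → ne ∘ cong inject₁) (λ ne → ne ∘ inject₁-injective)

module _ (p : Maybe (Fin (suc n))) (σ′ : Vec (Fin (suc n)) (suc n)) where

  inMinσ-inject₁⇔ : ∀ {i} → InMinσ (insertTop p σ′) (inject₁ i) ⇔ InMinσ σ′ i
  inMinσ-inject₁⇔ {i} = leastInOrb-inject₁⇔ inject₁≢zero⇔ p σ′ {suc i}

inMinσ-fromℕ-nothing : (σ′ : Vec (Fin (suc n)) (suc n)) → InMinσ (insertTop nothing σ′) (fromℕ n)
inMinσ-fromℕ-nothing σ′ = leastInOrb-fromℕ-insertTop-nothing σ′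

¬inMinσ-fromℕ-just : (c : Fin (suc n)) (σ′ : Vec (Fin (suc n)) (suc n)) →
  OneInOrbZero σ′ → ¬ InMinσ (insertTop (just c) σ′) (fromℕ n)
¬inMinσ-fromℕ-just {n} c σ′ (x , x≡1 , ox) =
  let y , top↝y , y≢0 = witness in ¬leastInOrb-fromℕ σ y (Equivalence.from (inOrb⇔reach σ) top↝y) y≢0
  where
  σ = insertTop (just c) σ′
  -- A nonzero element of the top's cycle smaller than the top: c itself, or 1 if c = 0.
  witness : ∃ λ y → Reach σ (fromℕ (suc n)) (inject₁ y) × ¬ inject₁ y ≡ zero
  witness with c ≟ zero
  ... | yes refl = x , reach-trans σ (reach-fromℕ-topImage (just zero) σ′)
                         (Equivalence.from (reach-inject₁⇔ (just zero) σ′) (Equivalence.to (inOrb⇔reach σ′) ox)) ,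
                       Equivalence.from (inject₁≢zero⇔ x) λ { refl → contradiction x≡1 λ () }
  ... | no  c≢0  = c , reach-fromℕ-topImage (just c) σ′ , Equivalence.from (inject₁≢zero⇔ c) c≢0

module _ (p : Maybe (Fin (suc n))) (σ′ : Vec (Fin (suc n)) (suc n)) (q : Maybe (Fin n)) (τ′ : Vec (Fin n) n) where

  private
    σ⇔ : ∀ {i} → InMinσ (insertTop p σ′) (inject₁ i) ⇔ InMinσ σ′ i
    σ⇔ = inMinσ-inject₁⇔ p σ′
    τ⇔ : ∀ {i} → IsCycleMin (insertTop q τ′) (inject₁ i) ⇔ IsCycleMin τ′ i
    τ⇔ = isCycleMin-inject₁⇔ q τ′
    open Equivalence

  sameMins-insertTop⇒ : SameMins (insertTop p σ′) (insertTop q τ′) → SameMins σ′ τ′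
  sameMins-insertTop⇒ S i = to τ⇔ ∘ proj₁ (S (inject₁ i)) ∘ from σ⇔ , to σ⇔ ∘ proj₂ (S (inject₁ i)) ∘ from τ⇔

  sameMins-insertTop⇐ : SameMins σ′ τ′ →
    (InMinσ (insertTop p σ′) (fromℕ n) → IsCycleMin (insertTop q τ′) (fromℕ n)) ×
    (IsCycleMin (insertTop q τ′) (fromℕ n) → InMinσ (insertTop p σ′) (fromℕ n)) →
    SameMins (insertTop p σ′) (insertTop q τ′)
  sameMins-insertTop⇐ S top x with topView x
  ... | below i refl = from τ⇔ ∘ proj₁ (S i) ∘ to σ⇔ , from σ⇔ ∘ proj₂ (S i) ∘ to τ⇔
  ... | at-top refl  = top

module _ (σ′ : Vec (Fin (suc (suc n))) (suc (suc n))) (τ′ : Vec (Fin (suc n)) (suc n)) where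

  good-insertTop-nothing⇔ : ∀ {k} →
    Good (suc (suc n)) (suc k) (insertTop nothing σ′ , insertTop nothing τ′) ⇔ Good (suc n) k (σ′ , τ′)
  good-insertTop-nothing⇔ = mk⇔
    (λ (cσ , cτ , one , S) →
      ℕ.suc-injective (trans (sym (cycles-insertTop-nothing σ′)) cσ) ,
      ℕ.suc-injective (trans (sym (cycles-insertTop-nothing τ′)) cτ) ,
      Equivalence.to (oneInOrbZero-insertTop⇔ nothing σ′) one ,
      sameMins-insertTop⇒ nothing σ′ nothing τ′ S)
    (λ (cσ , cτ , one , S) →
      trans (cycles-insertTop-nothing σ′) (cong suc cσ) ,
      trans (cycles-insertTop-nothing τ′) (cong suc cτ) ,
      Equivalence.from (oneInOrbZero-insertTop⇔ nothing σ′) one ,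
      sameMins-insertTop⇐ nothing σ′ nothing τ′ S
        ((λ _ → isCycleMin-fromℕ-nothing τ′) , (λ _ → inMinσ-fromℕ-nothing σ′)))

  good-insertTop-just⇔ : ∀ {k} c d →
    Good (suc (suc n)) k (insertTop (just c) σ′ , insertTop (just d) τ′) ⇔ Good (suc n) k (σ′ , τ′)
  good-insertTop-just⇔ c d = mk⇔
    (λ (cσ , cτ , one , S) →
      trans (sym (cycles-insertTop-just c σ′)) cσ ,
      trans (sym (cycles-insertTop-just d τ′)) cτ ,
      Equivalence.to (oneInOrbZero-insertTop⇔ (just c) σ′) one ,
      sameMins-insertTop⇒ (just c) σ′ (just d) τ′ S)
    (λ (cσ , cτ , one , S) →
      trans (cycles-insertTop-just c σ′) cσ ,
      trans (cycles-insertTop-just d τ′) cτ ,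
      Equivalence.from (oneInOrbZero-insertTop⇔ (just c) σ′) one ,
      sameMins-insertTop⇐ (just c) σ′ (just d) τ′ S
        ((λ min → contradiction min (¬inMinσ-fromℕ-just c σ′ one)) ,
         (λ min → contradiction min (¬isCycleMin-fromℕ-just d τ′))))

  ¬good-insertTop-nothing-zero : ¬ Good (suc (suc n)) 0 (insertTop nothing σ′ , insertTop nothing τ′)
  ¬good-insertTop-nothing-zero (cσ , _) = contradiction (trans (sym (cycles-insertTop-nothing σ′)) cσ) λ ()

  ¬good-insertTop-nothing-just : ∀ {k} d → ¬ Good (suc (suc n)) k (insertTop nothing σ′ , insertTop (just d) τ′)
  ¬good-insertTop-nothing-just d (_ , _ , _ , S) =
    ¬isCycleMin-fromℕ-just d τ′ (proj₁ (S (fromℕ (suc n))) (inMinσ-fromℕ-nothing σ′))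

  ¬good-insertTop-just-nothing : ∀ {k} c → ¬ Good (suc (suc n)) k (insertTop (just c) σ′ , insertTop nothing τ′)
  ¬good-insertTop-just-nothing c (_ , _ , one , S) =
    ¬inMinσ-fromℕ-just c σ′ (Equivalence.to (oneInOrbZero-insertTop⇔ (just c) σ′) one)
      (proj₂ (S (fromℕ (suc n))) (isCycleMin-fromℕ-nothing τ′))

-- Counting the pairs

goodPairs : (n k : ℕ) → List (Vec (Fin (suc n)) (suc n) × Vec (Fin n) n)
goodPairs n k = filter (good? n k) (cartesianProduct (perms (suc n)) (perms n))

goodPairs-unique : ∀ n k → Unique (goodPairs n k)
goodPairs-unique n k = Unique.filter⁺ (good? n k) (Unique.cartesianProduct⁺ (perms-unique (suc n)) (perms-unique n))

∈-goodPairs⇔ : ∀ {n k} σ τ → (σ , τ) ∈ goodPairs n k ⇔ ((Injective σ × Injective τ) × Good n k (σ , τ))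
∈-goodPairs⇔ {n} {k} σ τ = mk⇔
  (λ σ,τ∈ → let σ,τ∈perms , good = ∈.∈-filter⁻ (good? n k) {xs = cartesianProduct (perms (suc n)) (perms n)} σ,τ∈
                σ∈ , τ∈ = ∈.∈-cartesianProduct⁻ (perms (suc n)) (perms n) σ,τ∈perms
            in (Equivalence.to ∈-perms⇔ σ∈ , Equivalence.to ∈-perms⇔ τ∈) , good)
  (λ ((σ-inj , τ-inj) , good) → ∈.∈-filter⁺ (good? n k)
    (∈.∈-cartesianProduct⁺ (Equivalence.from ∈-perms⇔ σ-inj) (Equivalence.from ∈-perms⇔ τ-inj)) good)

module _ (n : ℕ) where

  private
    Pair : Set
    Pair = Vec (Fin (suc (suc n))) (suc (suc n)) × Vec (Fin (suc n)) (suc n)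

  -- Deleting the top elements of a pair counted by countPairs (suc (suc n)) leaves a pair counted by
  -- countPairs (suc n), together with the pointers recording where the top elements went.
  Code : Set
  Code = Maybe (Fin (suc (suc n))) × Maybe (Fin (suc n)) × Pair

  decode : Code → Vec (Fin (suc (suc (suc n)))) (suc (suc (suc n))) × Vec (Fin (suc (suc n))) (suc (suc n))
  decode (p , q , σ′ , τ′) = insertTop p σ′ , insertTop q τ′

  decode-injective : ∀ {c c′} → decode c ≡ decode c′ → c ≡ c′
  decode-injective {c} {c′} eq = trans (sym (encode-decode c)) (trans (cong encode eq) (encode-decode c′))
    where
    encode : _ → Code
    encode (σ , τ) = topPointer σ , topPointer τ , deleteTop σ , deleteTop τ
    encode-decode : ∀ c → encode (decode c) ≡ c
    encode-decode (p , q , σ′ , τ′) = cong₂ _,_ (topPointer-insertTop p σ′)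
      (cong₂ _,_ (topPointer-insertTop q τ′) (cong₂ _,_ (deleteTop-insertTop p σ′) (deleteTop-insertTop q τ′)))

  private
    pointers : List (Fin (suc (suc n)) × Fin (suc n))
    pointers = cartesianProduct (allFin (suc (suc n))) (allFin (suc n))

    fixedTag : Pair → Code
    fixedTag st = nothing , nothing , st

    movedTag : (Fin (suc (suc n)) × Fin (suc n)) × Pair → Code
    movedTag ((c , d) , st) = just c , just d , st

  fixedCodes : ℕ → List Code
  fixedCodes zero    = []
  fixedCodes (suc k) = map fixedTag (goodPairs (suc n) k)

  movedCodes : ℕ → List Code
  movedCodes k = map movedTag (cartesianProduct pointers (goodPairs (suc n) k))

  codes : ℕ → List Code
  codes k = fixedCodes k ++ movedCodes k

  codes-unique : ∀ k → Unique (codes k)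
  codes-unique k = Unique.++⁺ (fixed-unique k) moved-unique (disjoint k)
    where
    fixed-unique : ∀ k → Unique (fixedCodes k)
    fixed-unique zero    = []
    fixed-unique (suc k) = Unique.map⁺ (λ { refl → refl }) (goodPairs-unique (suc n) k)
    moved-unique : Unique (movedCodes k)
    moved-unique = Unique.map⁺ (λ { {(_ , _) , _} {(_ , _) , _} refl → refl })
      (Unique.cartesianProduct⁺ (Unique.cartesianProduct⁺ (Unique.allFin⁺ _) (Unique.allFin⁺ _)) (goodPairs-unique (suc n) k))
    disjoint : ∀ k {c} → ¬ (c ∈ fixedCodes k × c ∈ movedCodes k)
    disjoint zero    (() , _)
    disjoint (suc k) (c∈fixed , c∈moved) with ∈.∈-map⁻ fixedTag c∈fixed | ∈.∈-map⁻ movedTag c∈moved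
    ... | _ , _ , refl | _ , _ , ()

  length-codes : ∀ k → length (codes k) ≡ length (fixedCodes k) + suc (suc n) * suc n * countPairs (suc n) k
  length-codes k = begin
    length (fixedCodes k ++ movedCodes k)                     ≡⟨ List.length-++ (fixedCodes k) ⟩
    length (fixedCodes k) + length (movedCodes k)             ≡⟨ cong (_+_ (length (fixedCodes k))) length-movedCodes ⟩
    length (fixedCodes k) + suc (suc n) * suc n * countPairs (suc n) k ∎
    where
    open ≡-Reasoning
    length-movedCodes : length (movedCodes k) ≡ suc (suc n) * suc n * countPairs (suc n) k
    length-movedCodes = begin
      length (movedCodes k)                                     ≡⟨ List.length-map movedTag (cartesianProduct pointers (goodPairs (suc n) k)) ⟩
      length (cartesianProduct pointers (goodPairs (suc n) k))  ≡⟨ length-cartesianProduct pointers (goodPairs (suc n) k) ⟩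
      length pointers * countPairs (suc n) k                    ≡⟨ cong (_* countPairs (suc n) k) (length-cartesianProduct (allFin (suc (suc n))) (allFin (suc n))) ⟩
      length (allFin (suc (suc n))) * length (allFin (suc n)) * countPairs (suc n) k
        ≡⟨ cong₂ (λ a b → a * b * countPairs (suc n) k) (List.length-tabulate {n = suc (suc n)} id) (List.length-tabulate {n = suc n} id) ⟩
      suc (suc n) * suc n * countPairs (suc n) k ∎

  decode-∈-goodPairs : ∀ {k} p q σ′ τ′ → Injective σ′ → Injective τ′ →
    Good (suc (suc n)) k (decode (p , q , σ′ , τ′)) → decode (p , q , σ′ , τ′) ∈ goodPairs (suc (suc n)) k
  decode-∈-goodPairs p q σ′ τ′ σ′-inj τ′-inj good = Equivalence.from (∈-goodPairs⇔ (insertTop p σ′) (insertTop q τ′))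
    ((insertTop-injective p σ′ σ′-inj , insertTop-injective q τ′ τ′-inj) , good)

  codes-sound : ∀ {k c} → c ∈ codes k → decode c ∈ goodPairs (suc (suc n)) k
  codes-sound {k} c∈ with ∈.∈-++⁻ (fixedCodes k) c∈
  codes-sound {suc k} _ | inj₁ c∈fixed with ∈.∈-map⁻ fixedTag c∈fixed
  ... | (σ′ , τ′) , st∈ , refl =
    let (σ′-inj , τ′-inj) , good = Equivalence.to (∈-goodPairs⇔ σ′ τ′) st∈
    in decode-∈-goodPairs nothing nothing σ′ τ′ σ′-inj τ′-inj (Equivalence.from (good-insertTop-nothing⇔ σ′ τ′) good)
  codes-sound {k} _ | inj₂ c∈moved with ∈.∈-map⁻ movedTag c∈moved
  ... | ((c , d) , (σ′ , τ′)) , x∈ , refl =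
    let (σ′-inj , τ′-inj) , good = Equivalence.to (∈-goodPairs⇔ σ′ τ′) (proj₂ (∈.∈-cartesianProduct⁻ pointers (goodPairs (suc n) k) x∈))
    in decode-∈-goodPairs (just c) (just d) σ′ τ′ σ′-inj τ′-inj (Equivalence.from (good-insertTop-just⇔ σ′ τ′ c d) good)

  codes-complete : ∀ {k} p q σ′ τ′ → Injective σ′ → Injective τ′ →
    Good (suc (suc n)) k (decode (p , q , σ′ , τ′)) → (p , q , σ′ , τ′) ∈ codes k
  codes-complete {zero} nothing nothing σ′ τ′ _ _ good = contradiction good (¬good-insertTop-nothing-zero σ′ τ′)
  codes-complete {suc k} nothing nothing σ′ τ′ σ′-inj τ′-inj good = ∈.∈-++⁺ˡ (∈.∈-map⁺ fixedTag
    (Equivalence.from (∈-goodPairs⇔ σ′ τ′) ((σ′-inj , τ′-inj) , Equivalence.to (good-insertTop-nothing⇔ σ′ τ′) good)))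
  codes-complete {k} (just c) (just d) σ′ τ′ σ′-inj τ′-inj good = ∈.∈-++⁺ʳ (fixedCodes k) (∈.∈-map⁺ movedTag
    (∈.∈-cartesianProduct⁺ (∈.∈-cartesianProduct⁺ (∈.∈-allFin c) (∈.∈-allFin d))
      (Equivalence.from (∈-goodPairs⇔ σ′ τ′) ((σ′-inj , τ′-inj) , Equivalence.to (good-insertTop-just⇔ σ′ τ′ c d) good))))
  codes-complete nothing (just d) σ′ τ′ _ _ good = contradiction good (¬good-insertTop-nothing-just σ′ τ′ d)
  codes-complete (just c) nothing σ′ τ′ _ _ good = contradiction good (¬good-insertTop-just-nothing σ′ τ′ c)

  ∈-goodPairs⇔∈-decode-codes : ∀ {k z} → z ∈ goodPairs (suc (suc n)) k ⇔ z ∈ map decode (codes k)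
  ∈-goodPairs⇔∈-decode-codes {k} {σ , τ} = mk⇔ to from
    where
    to : (σ , τ) ∈ goodPairs (suc (suc n)) k → (σ , τ) ∈ map decode (codes k)
    to σ,τ∈ = subst (_∈ map decode (codes k)) decode-encode (∈.∈-map⁺ decode
      (codes-complete (topPointer σ) (topPointer τ) (deleteTop σ) (deleteTop τ)
        (deleteTop-injective σ σ-inj) (deleteTop-injective τ τ-inj) (subst (Good (suc (suc n)) k) (sym decode-encode) good)))
      where
      σ-inj = proj₁ (proj₁ (Equivalence.to (∈-goodPairs⇔ σ τ) σ,τ∈))
      τ-inj = proj₂ (proj₁ (Equivalence.to (∈-goodPairs⇔ σ τ) σ,τ∈))
      good = proj₂ (Equivalence.to (∈-goodPairs⇔ σ τ) σ,τ∈)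
      decode-encode : decode (topPointer σ , topPointer τ , deleteTop σ , deleteTop τ) ≡ (σ , τ)
      decode-encode = cong₂ _,_ (insertTop-deleteTop σ σ-inj) (insertTop-deleteTop τ τ-inj)
    from : (σ , τ) ∈ map decode (codes k) → (σ , τ) ∈ goodPairs (suc (suc n)) k
    from σ,τ∈ with ∈.∈-map⁻ decode σ,τ∈
    ... | _ , c∈ , refl = codes-sound c∈

  countPairs-suc-suc : ∀ k → countPairs (suc (suc n)) k ≡ length (fixedCodes k) + suc (suc n) * suc n * countPairs (suc n) k
  countPairs-suc-suc k = begin
    length (goodPairs (suc (suc n)) k)   ≡⟨ length-unique (goodPairs-unique _ k) (Unique.map⁺ decode-injective (codes-unique k))
                                                          ∈-goodPairs⇔∈-decode-codes ⟩
    length (map decode (codes k))         ≡⟨ List.length-map decode (codes k) ⟩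
    length (codes k)                      ≡⟨ length-codes k ⟩
    length (fixedCodes k) + suc (suc n) * suc n * countPairs (suc n) k ∎
    where open ≡-Reasoning

countPairs≡lsᵘ : ∀ n k → countPairs (suc n) k ≡ lsᵘ (suc n) k
countPairs≡lsᵘ zero    zero                = refl
countPairs≡lsᵘ zero    (suc zero)          = refl
countPairs≡lsᵘ zero    (suc (suc zero))    = refl
countPairs≡lsᵘ zero    (suc (suc (suc k))) = refl
countPairs≡lsᵘ (suc n) zero = begin
  countPairs (suc (suc n)) 0                     ≡⟨ countPairs-suc-suc n 0 ⟩
  suc (suc n) * suc n * countPairs (suc n) 0     ≡⟨ cong (suc (suc n) * suc n *_) (countPairs≡lsᵘ n 0) ⟩
  suc (suc n) * suc n * 0                        ≡⟨ ℕ.*-zeroʳ (suc (suc n) * suc n) ⟩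
  0 ∎
  where open ≡-Reasoning
countPairs≡lsᵘ (suc n) (suc k) = begin
  countPairs (suc (suc n)) (suc k)
    ≡⟨ countPairs-suc-suc n (suc k) ⟩
  length (fixedCodes n (suc k)) + suc (suc n) * suc n * countPairs (suc n) (suc k)
    ≡⟨ cong₂ _+_ (trans (List.length-map _ (goodPairs (suc n) k)) (countPairs≡lsᵘ n k))
                 (cong₂ _*_ (ℕ.*-comm (suc (suc n)) (suc n)) (countPairs≡lsᵘ n (suc k))) ⟩
  lsᵘ (suc (suc n)) (suc k) ∎
  where open ≡-Reasoning

-- The hypotheses only exclude n = 0: ls 0 0 = 1, but 1 ∈ Orb σ(0) is impossible when [n]₀ = {0}.
corollary8 : (n k : ℕ) → 1 ≤ k → k ≤ n → ∣ ls n k ∣ ≡ countPairs n k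
corollary8 zero    (suc k) _ ()
corollary8 (suc n) k       _ _ = trans (∣ls∣≡lsᵘ (suc n) k) (sym (countPairs≡lsᵘ n k))
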